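{- Let $\mathsf{JL}$ be a propositional justification logic (as described in the context) whose axioms include the schemes $\mathrm{jD}$: $\neg t:\bot$ and $\mathrm{j4}$: $t:A\rightarrow !t:t:A$. Then $\mathsf{JL}(\mathsf{FP})_{\mathcal{TCS}}$ is inconsistent.
   Context: Justification terms are built from justification variables $x,y,\dots$ and justification constants $c,\dots$ using binary application $\cdot$, binary sum $+$, and, depending on the logic, unary operations $!$, $?$, $\bar{?}$. Formulas: $A::= p\mid\bot\mid\neg A\mid A\wedge A\mid A\vee A\mid A\rightarrow A\mid t:A$. The basic logic $\mathsf{J}$ has axioms: all propositional tautologies; Sum: $s:A\rightarrow(s+t):A$, $s:A\rightarrow(t+s):A$; jK: $s:(A\rightarrow B)\rightarrow(t:A\rightarrow(s\cdot t):B)$. A justification logic $\mathsf{JL}$ is obtained by adding to $\mathsf{J}$ some of: jT: $t:A\rightarrow A$; jD: $t:\bot\rightarrow\bot$ (equivalently $\neg t:\bot$); j4: $t:A\rightarrow !t:t:A$; jB: $\neg A\rightarrow\bar{?}t:\neg t:A$; j5: $\neg t:A\rightarrow ?t:\neg t:A$ (with the term operations occurring in its axioms). Rules: Modus Ponens and Iterated Axiom Necessitation (IAN): $\vdash c_{i_n}:\dots:c_{i_1}:A$ for any axiom instance $A$, any constants, $n\ge1$. The total constant specification $\mathcal{TCS}$ is the set of all formulas produced by IAN; $\mathsf{JL}_{\mathcal{CS}}$ restricts IAN to a subset $\mathcal{CS}$. Fixed point extension: $p$ is justified in $A(p,q_1,\dots,q_n)$ if every occurrence of $p$ lies in the scope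 of some $t:$. $\mathcal{L}(\mathsf{FP})$ adds an $n$-ary operator $\delta_A$ for each such formula, and $\mathsf{JL}(\mathsf{FP})$ adds to $\mathsf{JL}$ (schemes ranging over $\mathcal{L}(\mathsf{FP})$) the axioms $\delta_A(B_1,\dots,B_n)\leftrightarrow A(\delta_A(B_1,\dots,B_n),B_1,\dots,B_n)$ for all $\mathcal{L}(\mathsf{FP})$-formulas $B_i$; $\mathcal{TCS}$ for $\mathsf{JL}(\mathsf{FP})$ consists of all $c_{i_n}:\dots:c_{i_1}:A$ with $A$ an axiom instance of $\mathsf{JL}(\mathsf{FP})$. -}

module Defs where

open import Data.Nat using (ℕ; zero; suc)
open import Data.Fin using (Fin; zero; suc)
open import Data.Bool using (Bool; true; false; T; _∧_; _∨_; not; if_then_else_)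
open import Data.List using (List; foldr)
open import Data.Vec using (Vec; lookup)
open import Data.Product using (Σ)
open import Relation.Binary.PropositionalEquality using (_≡_)

-- Which of the optional axiom schemes jT, jD, j4, jB, j5 the logic JL has.
record Logic : Set where
  field
    hasT hasD has4 hasB has5 : Bool
open Logic public

-- Justification terms; the unary operations !, ?̄, ? are present exactly
-- when the corresponding axiom (j4, jB, j5) is part of the logic.
data Tm (L : Logic) : Set where
  var   : ℕ → Tm L
  const : ℕ → Tm L
  _·_   : Tm L → Tm L → Tm L
  _⊕_   : Tm L → Tm L → Tm L
  !_    : {{_ : T (has4 L)}} → Tm L → Tm L
  ?̄_    : {{_ : T (hasB L)}} → Tm L → Tm L
  ¿_    : {{_ : T (has5 L)}} → Tm L → Tm L

-- Base-language formulas A(p, q₁,…,qₙ) with atoms among Fin (suc n):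
-- atom zero is p, atom (suc i) is q_{i+1}.
data BFm (L : Logic) (k : ℕ) : Set where
  atom : Fin k → BFm L k
  ⊥b   : BFm L k
  ¬b_  : BFm L k → BFm L k
  _∧b_ _∨b_ _⇒b_ : BFm L k → BFm L k → BFm L k
  _∶b_ : Tm L → BFm L k → BFm L k

-- p (= atom zero) is justified in A: every occurrence lies in the scope of some t:.
justified : ∀ {L k} → BFm L (suc k) → Bool
justified (atom zero)    = false
justified (atom (suc _)) = true
justified ⊥b             = true
justified (¬b A)         = justified A
justified (A ∧b B)       = justified A ∧ justified B
justified (A ∨b B)       = justified A ∧ justified B
justified (A ⇒b B)       = justified A ∧ justified B
justified (t ∶b A)       = true

-- Formulas of L(FP): atoms p_i (i : ℕ), plus δ_A(B₁,…,Bₙ) for each A(p,q₁..qₙ)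
-- in which p is justified.
data Fm (L : Logic) : Set where
  pv  : ℕ → Fm L
  ⊥'  : Fm L
  ¬'_ : Fm L → Fm L
  _∧'_ _∨'_ _⇒_ : Fm L → Fm L → Fm L
  _∶_ : Tm L → Fm L → Fm L
  δ   : (n : ℕ) (A : BFm L (suc n)) → T (justified A) → Vec (Fm L) n → Fm L

infixr 6 _∶_
infixr 4 _⇒_

subst : ∀ {L n} → BFm L (suc n) → Fm L → Vec (Fm L) n → Fm L
subst (atom zero)    C Bs = C
subst (atom (suc i)) C Bs = lookup Bs i
subst ⊥b             C Bs = ⊥'
subst (¬b A)         C Bs = ¬' subst A C Bs
subst (A ∧b B)       C Bs = subst A C Bs ∧' subst B C Bs
subst (A ∨b B)       C Bs = subst A C Bs ∨' subst B C Bs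
subst (A ⇒b B)       C Bs = subst A C Bs ⇒ subst B C Bs
subst (t ∶b A)       C Bs = t ∶ subst A C Bs

_⇔_ : ∀ {L} → Fm L → Fm L → Fm L
A ⇔ B = (A ⇒ B) ∧' (B ⇒ A)

eval : ∀ {L} → (Fm L → Bool) → Fm L → Bool
eval v (pv i)      = v (pv i)
eval v ⊥'          = false
eval v (¬' A)      = not (eval v A)
eval v (A ∧' B)    = eval v A ∧ eval v B
eval v (A ∨' B)    = eval v A ∨ eval v B
eval v (A ⇒ B)     = not (eval v A) ∨ eval v B
eval v (t ∶ A)     = v (t ∶ A)
eval v (δ n A j Bs) = v (δ n A j Bs)

Tautology : ∀ {L} → Fm L → Set
Tautology {L} A = (v : Fm L → Bool) → eval v A ≡ true

data Axiom (L : Logic) : Fm L → Set where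
  taut : ∀ {A} → Tautology A → Axiom L A
  sumˡ : ∀ s t A → Axiom L (s ∶ A ⇒ (s ⊕ t) ∶ A)
  sumʳ : ∀ s t A → Axiom L (s ∶ A ⇒ (t ⊕ s) ∶ A)
  jK   : ∀ s t A B → Axiom L (s ∶ (A ⇒ B) ⇒ (t ∶ A ⇒ (s · t) ∶ B))
  jT   : T (hasT L) → ∀ t A → Axiom L (t ∶ A ⇒ A)
  jD   : T (hasD L) → ∀ t → Axiom L (¬' (t ∶ ⊥'))
  j4   : (h : T (has4 L)) → ∀ t A → Axiom L (t ∶ A ⇒ (!_ {{h}} t) ∶ t ∶ A)
  jB   : (h : T (hasB L)) → ∀ t A → Axiom L (¬' A ⇒ (?̄_ {{h}} t) ∶ ¬' (t ∶ A))
  j5   : (h : T (has5 L)) → ∀ t A → Axiom L (¬' (t ∶ A) ⇒ (¿_ {{h}} t) ∶ ¬' (t ∶ A))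
  fp   : ∀ n A (j : T (justified A)) (Bs : Vec (Fm L) n) →
         Axiom L (δ n A j Bs ⇔ subst A (δ n A j Bs) Bs)

-- c_{iₙ} : … : c_{i₁} : A, with the given list of constant indices (innermost first).
boxes : ∀ {L} → List ℕ → Fm L → Fm L
boxes cs A = foldr (λ c B → const c ∶ B) A cs

-- Derivability in JL(FP)_TCS: axioms, Modus Ponens, Iterated Axiom Necessitation (n ≥ 1).
data ⊢_[_] (L : Logic) : Fm L → Set where
  ax  : ∀ {A} → Axiom L A → ⊢ L [ A ]
  mp  : ∀ {A B} → ⊢ L [ A ⇒ B ] → ⊢ L [ A ] → ⊢ L [ B ]
  ian : ∀ {A} (c : ℕ) (cs : List ℕ) → Axiom L A → ⊢ L [ const c ∶ boxes cs A ]

Inconsistent : Logic → Set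
Inconsistent L = ⊢ L [ ⊥' ]

module Submission where

-- For a term y, the formula A_y(p) = ¬ y:p justifies p, so L(FP) has
-- a fixed point D_y ↔ ¬ y:D_y.  Using j4 and jD one refutes y:D_y, i.e.
-- derives ¬ y:D_y, for every y.  By internalization (every derivation of B
-- yields a term t with ⊢ t:B) this derivation, followed by the fixed point
-- axiom, gives a term for D_y.  The crux is that the internalizing term
-- depends only on the SHAPE of the derivation, and the derivations for
-- different y all have the same shape; so there is one term r with
-- ⊢ r:D_y for every y.  Choosing y = r yields both r:D_r and ¬ r:D_r.

open import Defs
open import Data.Bool using (T; true; false; not; _∧_; _∨_)
open import Function using (_∘_)
open import Data.Unit using (tt)
open import Data.Fin using (zero)
open import Data.List using ([]; _∷_)
open import Data.Vec using ([])
open import Relation.Binary.PropositionalEquality as Eq using (_≡_; refl)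

syllogism-table : ∀ a b d → (not (not a ∨ b) ∨ (not (not b ∨ d) ∨ (not a ∨ d))) ≡ true
syllogism-table true  true  true  = refl
syllogism-table true  true  false = refl
syllogism-table true  false true  = refl
syllogism-table true  false false = refl
syllogism-table false true  true  = refl
syllogism-table false true  false = refl
syllogism-table false false true  = refl
syllogism-table false false false = refl

distribution-table : ∀ a b d → (not (not a ∨ (not b ∨ d)) ∨ (not (not a ∨ b) ∨ (not a ∨ d))) ≡ true
distribution-table true  true  true  = refl
distribution-table true  true  false = refl
distribution-table true  false true  = refl
distribution-table true  false false = refl
distribution-table false true  true  = refl
distribution-table false true  false = refl
distribution-table false false true  = refl
distribution-table false false false = refl

contraposition-table : ∀ a b → (not (not a ∨ b) ∨ (not (not b) ∨ not a)) ≡ true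
contraposition-table true  true  = refl
contraposition-table true  false = refl
contraposition-table false true  = refl
contraposition-table false false = refl

iff-elimˡ-table : ∀ a b → (not ((not a ∨ b) ∧ (not b ∨ a)) ∨ (not a ∨ b)) ≡ true
iff-elimˡ-table true  true  = refl
iff-elimˡ-table true  false = refl
iff-elimˡ-table false true  = refl
iff-elimˡ-table false false = refl

iff-elimʳ-table : ∀ a b → (not ((not a ∨ b) ∧ (not b ∨ a)) ∨ (not b ∨ a)) ≡ true
iff-elimʳ-table true  true  = refl
iff-elimʳ-table true  false = refl
iff-elimʳ-table false true  = refl
iff-elimʳ-table false false = refl

negation-table : ∀ a → (not (not a) ∨ (not a ∨ false)) ≡ true
negation-table true  = refl
negation-table false = refl

explosion-table : ∀ a → (not a ∨ (not (not a) ∨ false)) ≡ true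
explosion-table true  = refl
explosion-table false = refl

module _ {L : Logic} where

  syllogism : ∀ {A B C} → ⊢ L [ A ⇒ B ] → ⊢ L [ B ⇒ C ] → ⊢ L [ A ⇒ C ]
  syllogism {A} {B} {C} = mp ∘ mp (ax (taut λ v → syllogism-table (eval v A) (eval v B) (eval v C)))

  distribution : ∀ {A B C} → ⊢ L [ A ⇒ (B ⇒ C) ] → ⊢ L [ A ⇒ B ] → ⊢ L [ A ⇒ C ]
  distribution {A} {B} {C} d =
    mp (mp (ax (taut λ v → distribution-table (eval v A) (eval v B) (eval v C))) d)

  contraposition : ∀ {A B} → ⊢ L [ A ⇒ B ] → ⊢ L [ ¬' B ] → ⊢ L [ ¬' A ]
  contraposition {A} {B} d = mp (mp (ax (taut λ v → contraposition-table (eval v A) (eval v B))) d)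

  iff-elimˡ : ∀ {A B} → ⊢ L [ A ⇔ B ] → ⊢ L [ A ⇒ B ]
  iff-elimˡ {A} {B} = mp (ax (taut λ v → iff-elimˡ-table (eval v A) (eval v B)))

  iff-elimʳ : ∀ {A B} → ⊢ L [ A ⇔ B ] → ⊢ L [ B ⇒ A ]
  iff-elimʳ {A} {B} = mp (ax (taut λ v → iff-elimʳ-table (eval v A) (eval v B)))

  negation-axiom : ∀ A → Axiom L (¬' A ⇒ (A ⇒ ⊥'))
  negation-axiom A = taut λ v → negation-table (eval v A)

  explosion : ∀ {A} → ⊢ L [ A ] → ⊢ L [ ¬' A ] → ⊢ L [ ⊥' ]
  explosion {A} = mp ∘ mp (ax (taut λ v → explosion-table (eval v A)))

  apply : ∀ {s t A B} → ⊢ L [ s ∶ (A ⇒ B) ] → ⊢ L [ t ∶ A ⇒ (s · t) ∶ B ]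
  apply {s} {t} {A} {B} = mp (ax (jK s t A B))

-- The
-- term is read off the derivation tree only — axioms and IAN-instances
-- become a constant, Modus Ponens becomes application — so it does not
-- depend on the formulas occurring in the derivation.
proofTerm : ∀ {L A} → ⊢ L [ A ] → Tm L
proofTerm (ax _)      = const 0
proofTerm (mp d e)    = proofTerm d · proofTerm e
proofTerm (ian _ _ _) = const 0

internalize : ∀ {L A} (d : ⊢ L [ A ]) → ⊢ L [ proofTerm d ∶ A ]
internalize (ax a)       = ian 0 [] a
internalize (mp d e)     = mp (apply (internalize d)) (internalize e)
internalize (ian k cs a) = ian 0 (k ∷ cs) a

-- With jD and j4, a justification y of A cannot coexist with a derivable
-- justification u of A ⇒ ¬ y:A: from y:A we get (u·y):¬y:A and !y:y:A,
-- hence a justification of ⊥, which jD forbids.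
self-refutation : ∀ {L A u y} → T (hasD L) → (h4 : T (has4 L)) →
                  ⊢ L [ u ∶ (A ⇒ ¬' (y ∶ A)) ] → ⊢ L [ ¬' (y ∶ A) ]
self-refutation {L} {A} {u} {y} hD h4 d = contraposition y∶A⇒w∶⊥ (ax (jD hD w))
  where
  c !y w : Tm L
  c = const 0
  !y = !_ {{h4}} y
  w = (c · (u · y)) · !y

  y∶A⇒negation : ⊢ L [ y ∶ A ⇒ (c · (u · y)) ∶ (y ∶ A ⇒ ⊥') ]
  y∶A⇒negation = syllogism (apply d) (apply (ian 0 [] (negation-axiom (y ∶ A))))

  y∶A⇒w∶⊥ : ⊢ L [ y ∶ A ⇒ w ∶ ⊥' ]
  y∶A⇒w∶⊥ = distribution (syllogism y∶A⇒negation (ax (jK (c · (u · y)) !y (y ∶ A) ⊥'))) (ax (j4 h4 y A))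

module Diagonal (L : Logic) (hD : T (hasD L)) (h4 : T (has4 L)) where

  D : Tm L → Fm L
  D y = δ 0 (¬b (y ∶b atom zero)) tt []

  unfold : ∀ y → ⊢ L [ D y ⇒ ¬' (y ∶ D y) ]
  unfold y = iff-elimˡ (ax (fp 0 _ tt []))

  fold : ∀ y → ⊢ L [ ¬' (y ∶ D y) ⇒ D y ]
  fold y = iff-elimʳ (ax (fp 0 _ tt []))

  refute : ∀ y → ⊢ L [ ¬' (y ∶ D y) ]
  refute y = self-refutation hD h4 (internalize (unfold y))

  -- Hence every D_y is a theorem ...
  D-theorem : ∀ y → ⊢ L [ D y ]
  D-theorem y = mp (fold y) (refute y)

  -- ... and it is always justified by the same term r, since the
  -- derivations D-theorem y differ only in their formulas.
  r : Tm L
  r = proofTerm (D-theorem (const 0))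

  D-term-uniform : ∀ y → proofTerm (D-theorem y) ≡ r
  D-term-uniform y = refl

  r-justifies-D : ∀ y → ⊢ L [ r ∶ D y ]
  r-justifies-D y = Eq.subst (λ t → ⊢ L [ t ∶ D y ]) (D-term-uniform y) (internalize (D-theorem y))

  contradiction : ⊢ L [ ⊥' ]
  contradiction = explosion (r-justifies-D r) (refute r)

theorem19 : (L : Logic) → T (hasD L) → T (has4 L) → Inconsistent L
theorem19 L hD h4 = Diagonal.contradiction L hD h4
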